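{- Let $k \ge 1$ and let $G$ be a bipartite graph with bipartition $(X, Y)$. If $\beta^k(G, X) \ge 1$, then $G$ contains $k$ pairwise edge-disjoint matchings, each of which covers all vertices in $X$.
   Context: All graphs are finite and simple. For $S\subseteq V(G)$, $\Lambda^k_G(S)$ is the set of vertices of $G$ having at least $k$ neighbors in $S$. For a bipartite graph $G$ with bipartition $(X,Y)$, the weak bipartite $k$-th binding number is $\beta^k(G,X)=\min\{|\Lambda^k_G(S)|/|S| : S\subseteq X,\ |S|\ge k\}$, with $\beta^k(G,X)=0$ if $|X|<k$. -}

module Defs where

open import Data.Bool using (Bool; true; false)
open import Data.Nat using (ℕ; zero; suc; _≤?_)
open import Data.Fin using (Fin)
open import Data.Fin.Subset using (Subset; ∣_∣; _∩_; inside; outside)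
open import Data.Vec using (Vec; []; _∷_; tabulate)
open import Data.List using (List; []; _∷_; [_]; map; _++_; filter; foldr)
open import Data.Integer using (+_)
open import Data.Rational using (ℚ; 0ℚ; _⊓_) renaming (_/_ to _÷_)
open import Relation.Nullary.Decidable using (⌊_⌋)
open import Relation.Binary.PropositionalEquality using (_≡_; _≢_)
open import Function.Definitions using (Injective)
open import Data.Product using (Σ; _×_)

-- A finite simple bipartite graph with bipartition (X, Y),
-- X = Fin m, Y = Fin n; adj x y = true iff xy is an edge.
record BipartiteGraph : Set where
  field
    m   : ℕ
    n   : ℕ
    adj : Fin m → Fin n → Bool
open BipartiteGraph public

nbrX : (G : BipartiteGraph) → Fin (n G) → Subset (m G)
nbrX G y = tabulate (λ x → adj G x y)

-- Λ^k_G(S) for S ⊆ X: the vertices with at least k neighbours in S.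
-- (Vertices of X have no neighbours in S ⊆ X, so Λ^k_G(S) ⊆ Y for k ≥ 1.)
Λ : ℕ → (G : BipartiteGraph) → Subset (m G) → Subset (n G)
Λ k G S = tabulate (λ y → ⌊ k ≤? ∣ S ∩ nbrX G y ∣ ⌋)

allSubsets : (m : ℕ) → List (Subset m)
allSubsets zero = [ [] ]
allSubsets (suc m) = map (inside ∷_) (allSubsets m) ++ map (outside ∷_) (allSubsets m)

-- a / b as a rational (only used with b = |S| ≥ k ≥ 1; value at b = 0 is irrelevant)
ratio : ℕ → ℕ → ℚ
ratio a zero = 0ℚ
ratio a (suc b) = (+ a) ÷ suc b

minimum : List ℚ → ℚ
minimum [] = 0ℚ
minimum (q ∷ qs) = foldr _⊓_ q qs

-- weak bipartite k-th binding number β^k(G, X):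
-- min { |Λ^k_G(S)| / |S| : S ⊆ X, |S| ≥ k }, and 0 if |X| < k
-- (then there is no such S and the minimum over the empty list is 0).
β : ℕ → BipartiteGraph → ℚ
β k G = minimum (map (λ S → ratio ∣ Λ k G S ∣ ∣ S ∣)
                     (filter (λ S → k ≤? ∣ S ∣) (allSubsets (m G))))

-- A matching of G covering every vertex of X: it matches each x ∈ X to a
-- distinct neighbour M x ∈ Y, i.e. its edge set is { x (M x) : x ∈ X }.
record XMatching (G : BipartiteGraph) : Set where
  field
    mate      : Fin (m G) → Fin (n G)
    isEdge    : ∀ x → adj G x (mate x) ≡ true
    injective : Injective _≡_ _≡_ mate
open XMatching public

-- Two such matchings are edge-disjoint iff no edge x (M x) lies in both,
-- i.e. M₁ x ≠ M₂ x for every x ∈ X.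
EdgeDisjoint : {G : BipartiteGraph} → XMatching G → XMatching G → Set
EdgeDisjoint M₁ M₂ = ∀ x → mate M₁ x ≢ mate M₂ x

{-# OPTIONS --safe #-}
-- Gale's supply–demand theorem yields a subgraph H of G in which every vertex of X
-- has degree k and every vertex of Y degree at most k. Its condition
-- k|S| ≤ Σ_y min(k, d_S(y)) holds for |S| ≥ k because |Λ^k(S)| ≥ |S|, and for
-- |S| < k because S extends to a k-set T and each of the at least k vertices of
-- Λ^k(T) is adjacent to all of T ⊇ S. Completing H to a k-regular bipartite
-- multigraph on X ⊎ Y without X–X edges and splitting it into k perfect matchings
-- (Hall's condition, again via Gale's theorem) gives k matchings from X into Y that
-- share an edge only where it has multiplicity at least 2, which never happens in H.
-- Gale's theorem is proved by induction on the total supply: either a tight set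
-- splits the problem into two smaller ones, or every set has slack and one unit can
-- be shipped along any usable edge.

module Submission where

open import Defs
open import Data.Nat using (ℕ; _≥_)
open import Data.Fin using (Fin)
open import Data.Rational using (1ℚ) renaming (_≤_ to _≤ℚ_)
open import Data.Product using (Σ)
open import Relation.Binary.PropositionalEquality using (_≢_)

open import Data.Bool using (Bool; true; false; not; _∧_; _∨_)
open import Data.Fin using (zero; suc; _↑ˡ_; _↑ʳ_; splitAt)
import Data.Fin.Properties as Fin
open import Data.Fin.Properties using (splitAt-↑ˡ; splitAt-↑ʳ; splitAt⁻¹-↑ʳ; ↑ˡ-injective)
open import Data.Fin.Subset using (Subset; ∣_∣; _⊆_; _∩_; _∪_; ∁; ⁅_⁆; ⊥; ⊤; inside; outside)
open import Data.Fin.Subset.Properties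
  using (anySubset?; x∈⁅y⁆⇒x≡y; in⊆in; s⊆s; ⊆⊤; ∣⊤∣≡n; _∈?_; p⊂q⇒∣p∣<∣q∣; p∩q⊆p; x∈p∩q⁻; x∈p∩q⁺;
         p⊆q⇒∣p∣≤∣q∣; ∣p∣≤n)
import Data.Integer as ℤ
import Data.Integer.Properties as ℤ
open import Data.List using ([]; _∷_; map; filter; foldr)
open import Data.List.Membership.Propositional using (_∈_)
open import Data.List.Membership.Propositional.Properties using (∈-map⁺; ∈-filter⁺; ∈-filter⁻; ∈-++⁺ˡ; ∈-++⁺ʳ)
open import Data.List.Relation.Unary.Any using (here; there)
open import Data.Nat using (zero; suc; _+_; _*_; _∸_; _≤_; _<_; z≤n; s≤s; _⊓_; _≤?_; _<?_; _≟_)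
open import Data.Nat.Induction using (<-wellFounded)
open import Data.Nat.Properties
open import Algebra.Properties.Semiring.Sum +-*-semiring
  using (sum; ∑-distrib-+; ∑-comm; sum-cong-≗; *-distribˡ-sum; sum-replicate-zero)
open import Data.Product using (∃; ∃₂; _×_; _,_; proj₁; proj₂)
open import Data.Rational using (ℚ; *≤*) renaming (_⊓_ to _⊓ℚ_)
open import Data.Rational.Properties using (p⊓q≤p; p⊓q≤q; toℚᵘ-fromℚᵘ; toℚᵘ-mono-≤)
  renaming (≤-refl to ≤ℚ-refl; ≤-trans to ≤ℚ-trans)
open import Data.Rational.Unnormalised as ℚᵘ using (mkℚᵘ)
import Data.Rational.Unnormalised.Properties as ℚᵘ
open import Data.Sum using (_⊎_; inj₁; inj₂)
open import Data.Vec using ([]; _∷_; lookup; tabulate)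
open import Data.Vec.Properties using (lookup-replicate; lookup-map; lookup-zipWith; lookup⇒[]=; lookup∘tabulate)
open import Function.Definitions using (Injective)
open import Induction.WellFounded using (Acc; acc)
open import Relation.Binary.PropositionalEquality
  using (_≡_; refl; sym; trans; cong; cong₂; subst; subst₂; module ≡-Reasoning)
open import Relation.Nullary using (¬_; Dec; yes; no; contradiction)
open import Relation.Nullary.Decidable using (⌊_⌋; _×-dec_)

private variable
  p q : ℕ

-- Finite sums

sum-mono-≤ : {f g : Fin p → ℕ} → (∀ i → f i ≤ g i) → sum f ≤ sum g
sum-mono-≤ {zero}  f≤g = z≤n
sum-mono-≤ {suc p} f≤g = +-mono-≤ (f≤g zero) (sum-mono-≤ (λ i → f≤g (suc i)))

≤-sum : ∀ (f : Fin p → ℕ) i → f i ≤ sum f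
≤-sum f zero    = m≤m+n _ _
≤-sum f (suc i) = ≤-trans (≤-sum (λ j → f (suc j)) i) (m≤n+m _ _)

+-≤-sum : ∀ (f : Fin p → ℕ) {i j} → i ≢ j → f i + f j ≤ sum f
+-≤-sum f {zero}  {zero}  i≢j = contradiction refl i≢j
+-≤-sum f {zero}  {suc j} _   = +-monoʳ-≤ (f zero) (≤-sum (λ l → f (suc l)) j)
+-≤-sum f {suc i} {zero}  _   = ≤-trans (≤-reflexive (+-comm (f (suc i)) (f zero)))
                                   (+-monoʳ-≤ (f zero) (≤-sum (λ l → f (suc l)) i))
+-≤-sum f {suc i} {suc j} i≢j = ≤-trans (+-≤-sum (λ l → f (suc l)) (λ i≡j → i≢j (cong suc i≡j)))
                                   (m≤n+m _ (f zero))

sum-∸ : (f g : Fin p → ℕ) → (∀ i → g i ≤ f i) → sum (λ i → f i ∸ g i) + sum g ≡ sum f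
sum-∸ f g g≤f = trans (sym (∑-distrib-+ (λ i → f i ∸ g i) g)) (sum-cong-≗ (λ i → m∸n+n≡m (g≤f i)))

sum>0⇒∃>0 : (f : Fin p → ℕ) → 0 < sum f → ∃ λ i → 0 < f i
sum>0⇒∃>0 {suc p} f Σf>0 with f zero in f₀≡
... | suc _ = zero , subst (0 <_) (sym f₀≡) (s≤s z≤n)
... | zero with sum>0⇒∃>0 (λ i → f (suc i)) Σf>0
...   | i , fi>0 = suc i , fi>0

sum-≤⇒≗ : (f g : Fin p → ℕ) → (∀ i → f i ≤ g i) → sum g ≤ sum f → ∀ i → f i ≡ g i
sum-≤⇒≗ f g f≤g Σg≤Σf i = ≤-antisym (f≤g i) (m∸n≡0⇒m≤n (n≤0⇒n≡0 (≤-trans (≤-sum d i) Σd≤0)))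
  where
    d = λ j → g j ∸ f j
    Σd≤0 : sum d ≤ 0
    Σd≤0 = +-cancelʳ-≤ (sum f) (sum d) 0 (≤-trans (≤-reflexive (sum-∸ g f f≤g)) Σg≤Σf)

sum-↑ : ∀ p (f : Fin (p + q) → ℕ) → sum f ≡ sum (λ i → f (i ↑ˡ q)) + sum (λ j → f (p ↑ʳ j))
sum-↑ zero    f = refl
sum-↑ (suc p) f = trans (cong (f zero +_) (sum-↑ p (λ i → f (suc i)))) (sym (+-assoc (f zero) _ _))

infixr 7 _·_

_·_ : Bool → ℕ → ℕ
true  · v = v
false · v = 0

·-≤ : ∀ s v → s · v ≤ v
·-≤ true  v = ≤-refl
·-≤ false v = z≤n

0<·⇒true : ∀ s {v} → 0 < s · v → s ≡ true
0<·⇒true true _ = refl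

·-mono-≤ : ∀ s {v w} → v ≤ w → s · v ≤ s · w
·-mono-≤ true  v≤w = v≤w
·-mono-≤ false _   = z≤n

·-∸ : ∀ s v w → s · (v ∸ w) ≡ s · v ∸ s · w
·-∸ true  v w = refl
·-∸ false v w = refl

·-comm : ∀ s t v → s · t · v ≡ t · s · v
·-comm true  t     v = refl
·-comm false true  v = refl
·-comm false false v = refl

·-∧ : ∀ s t v → (s ∧ t) · v ≡ s · t · v
·-∧ true  t v = refl
·-∧ false t v = refl

·-∨ : ∀ s t v → (s ∨ t) · v ≡ s · v + t · not s · v
·-∨ true  true  v = sym (+-identityʳ v)
·-∨ true  false v = sym (+-identityʳ v)
·-∨ false true  v = refl
·-∨ false false v = refl

·-∁ : ∀ s v → s · v + not s · v ≡ v
·-∁ true  v = +-identityʳ v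
·-∁ false v = refl

·-sum : ∀ s (f : Fin p → ℕ) → s · sum f ≡ sum (λ i → s · f i)
·-sum true  f = refl
·-sum {p} false f = sym (sum-replicate-zero p)

restrict : Subset p → (Fin p → ℕ) → Fin p → ℕ
restrict S f i = lookup S i · f i

∑⟨_⟩ : Subset p → (Fin p → ℕ) → ℕ
∑⟨ S ⟩ f = sum (restrict S f)

∑⟨⟩-≤ : ∀ S (f : Fin p → ℕ) → ∑⟨ S ⟩ f ≤ sum f
∑⟨⟩-≤ S f = sum-mono-≤ (λ i → ·-≤ (lookup S i) (f i))

∑⟨⟩-const : ∀ (S : Subset p) c → ∑⟨ S ⟩ (λ _ → c) ≡ c * ∣ S ∣
∑⟨⟩-const []            c = sym (*-zeroʳ c)
∑⟨⟩-const (inside ∷ S)  c = trans (cong (c +_) (∑⟨⟩-const S c)) (sym (*-suc c ∣ S ∣))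
∑⟨⟩-const (outside ∷ S) c = ∑⟨⟩-const S c

∣∣≡∑⟨⟩ : ∀ (S : Subset p) → ∣ S ∣ ≡ ∑⟨ S ⟩ (λ _ → 1)
∣∣≡∑⟨⟩ S = sym (trans (∑⟨⟩-const S 1) (*-identityˡ ∣ S ∣))

∑⟨∩⟩ : ∀ (S T : Subset p) f → ∑⟨ S ∩ T ⟩ f ≡ ∑⟨ S ⟩ (restrict T f)
∑⟨∩⟩ S T f = sum-cong-≗ λ i →
  trans (cong (_· f i) (lookup-zipWith _∧_ i S T)) (·-∧ (lookup S i) (lookup T i) (f i))

restrict-∁ : ∀ (S : Subset p) f i → restrict S f i + restrict (∁ S) f i ≡ f i
restrict-∁ S f i = trans (cong (λ s → lookup S i · f i + s · f i) (lookup-map i not S)) (·-∁ (lookup S i) (f i))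

∑⟨∁⟩ : ∀ (S : Subset p) f → ∑⟨ S ⟩ f + ∑⟨ ∁ S ⟩ f ≡ sum f
∑⟨∁⟩ S f = trans (sym (∑-distrib-+ (restrict S f) (restrict (∁ S) f))) (sum-cong-≗ (restrict-∁ S f))

∑⟨∪⟩ : ∀ (S T : Subset p) f → ∑⟨ S ∪ T ⟩ f ≡ ∑⟨ S ⟩ f + ∑⟨ T ⟩ (restrict (∁ S) f)
∑⟨∪⟩ S T f = trans (sum-cong-≗ λ i → trans (cong (_· f i) (lookup-zipWith _∨_ i S T)) (trans
    (·-∨ (lookup S i) (lookup T i) (f i))
    (cong (λ s → lookup S i · f i + lookup T i · s · f i) (sym (lookup-map i not S)))))
  (∑-distrib-+ (restrict S f) (restrict T (restrict (∁ S) f)))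

∑⟨⊥⟩ : ∀ (f : Fin p → ℕ) → ∑⟨ ⊥ ⟩ f ≡ 0
∑⟨⊥⟩ {p} f = trans (sum-cong-≗ λ i → cong (_· f i) (lookup-replicate i false)) (sum-replicate-zero p)

∑⟨⁅⁆⟩ : ∀ (j : Fin p) f → ∑⟨ ⁅ j ⁆ ⟩ f ≡ f j
∑⟨⁅⁆⟩ zero    f = trans (cong (f zero +_) (∑⟨⊥⟩ (λ i → f (suc i)))) (+-identityʳ (f zero))
∑⟨⁅⁆⟩ (suc j) f = ∑⟨⁅⁆⟩ j (λ i → f (suc i))

⁅⁆-sym : ∀ (i j : Fin p) → lookup ⁅ i ⁆ j ≡ lookup ⁅ j ⁆ i
⁅⁆-sym zero    zero    = refl
⁅⁆-sym zero    (suc j) = lookup-replicate j false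
⁅⁆-sym (suc i) zero    = sym (lookup-replicate i false)
⁅⁆-sym (suc i) (suc j) = ⁅⁆-sym i j

⁅⁆-·-≤ : ∀ {j : Fin p} {c} (f : Fin p → ℕ) → c ≤ f j → ∀ i → lookup ⁅ j ⁆ i · c ≤ f i
⁅⁆-·-≤ {j = j} f c≤fj i with lookup ⁅ j ⁆ i in i∈⁅j⁆
... | true  = subst (λ l → _ ≤ f l) (sym (x∈⁅y⁆⇒x≡y j (lookup⇒[]= i ⁅ j ⁆ i∈⁅j⁆))) c≤fj
... | false = z≤n

∑⟨⟩-∸-⁅⁆ : ∀ S (f : Fin p → ℕ) {j c} → c ≤ f j →
           ∑⟨ S ⟩ (λ i → f i ∸ lookup ⁅ j ⁆ i · c) + lookup S j · c ≡ ∑⟨ S ⟩ f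
∑⟨⟩-∸-⁅⁆ S f {j} {c} c≤fj = begin
  ∑⟨ S ⟩ (λ i → f i ∸ δ i) + lookup S j · c
    ≡⟨ cong₂ _+_ (sum-cong-≗ λ i → ·-∸ (lookup S i) (f i) (δ i))
                 (sym (∑⟨⁅⁆⟩ j (λ i → lookup S i · c))) ⟩
  sum (λ i → restrict S f i ∸ restrict S δ i) + ∑⟨ ⁅ j ⁆ ⟩ (λ i → lookup S i · c)
    ≡⟨ cong (sum (λ i → restrict S f i ∸ restrict S δ i) +_)
            (sum-cong-≗ λ i → ·-comm (lookup ⁅ j ⁆ i) (lookup S i) c) ⟩
  sum (λ i → restrict S f i ∸ restrict S δ i) + ∑⟨ S ⟩ δ
    ≡⟨ sum-∸ (restrict S f) (restrict S δ) (λ i → ·-mono-≤ (lookup S i) (⁅⁆-·-≤ f c≤fj i)) ⟩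
  ∑⟨ S ⟩ f ∎
  where
    open ≡-Reasoning
    δ = λ i → lookup ⁅ j ⁆ i · c

∑⟨⟩-<-sum : ∀ S (f : Fin p → ℕ) {j} → lookup S j ≡ false → 0 < f j → ∑⟨ S ⟩ f < sum f
∑⟨⟩-<-sum S f {j} j∉S 0<fj = begin-strict
  ∑⟨ S ⟩ f                 <⟨ m<m+n (∑⟨ S ⟩ f) 0<fj ⟩
  ∑⟨ S ⟩ f + f j           ≤⟨ +-monoʳ-≤ (∑⟨ S ⟩ f) (≤-trans fj≤ (≤-sum (restrict (∁ S) f) j)) ⟩
  ∑⟨ S ⟩ f + ∑⟨ ∁ S ⟩ f    ≡⟨ ∑⟨∁⟩ S f ⟩
  sum f                    ∎
  where
    open ≤-Reasoning
    fj≤ : f j ≤ restrict (∁ S) f j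
    fj≤ = ≤-reflexive (cong (_· f j) (sym (trans (lookup-map j not S) (cong not j∉S))))

-- Gale's supply–demand theorem

column : (Fin p → Fin q → ℕ) → Fin q → ℕ
column g y = sum (λ x → g x y)

capacity : (Fin q → ℕ) → (Fin p → Fin q → ℕ) → Subset p → ℕ
capacity b u S = sum (λ y → b y ⊓ ∑⟨ S ⟩ (λ x → u x y))

Feasible : (Fin p → ℕ) → (Fin q → ℕ) → (Fin p → Fin q → ℕ) → Set
Feasible a b u = ∀ S → ∑⟨ S ⟩ a ≤ capacity b u S

record Transport (a : Fin p → ℕ) (b : Fin q → ℕ) (u : Fin p → Fin q → ℕ) : Set where
  field
    flow   : Fin p → Fin q → ℕ
    flow≤u : ∀ x y → flow x y ≤ u x y
    supply : ∀ x → sum (flow x) ≡ a x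
    demand : ∀ y → column flow y ≤ b y
open Transport

restrictRows : Subset p → (Fin p → Fin q → ℕ) → Fin p → Fin q → ℕ
restrictRows S u x y = lookup S x · u x y

null-transport : {a : Fin p → ℕ} {b : Fin q → ℕ} {u : Fin p → Fin q → ℕ} → sum a ≡ 0 → Transport a b u
null-transport {p} {q} {a} Σa≡0 = record
  { flow   = λ _ _ → 0
  ; flow≤u = λ _ _ → z≤n
  ; supply = λ x → trans (sum-replicate-zero q) (sym (n≤0⇒n≡0 (subst (a x ≤_) Σa≡0 (≤-sum a x))))
  ; demand = λ y → subst (_≤ _) (sym (sum-replicate-zero p)) z≤n
  }

merge : {a₁ a₂ a : Fin p → ℕ} {b₁ b₂ b : Fin q → ℕ} {u₁ u₂ u : Fin p → Fin q → ℕ} →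
        (T₁ : Transport a₁ b₁ u₁) → Transport a₂ b₂ u₂ →
        (∀ x → a₁ x + a₂ x ≡ a x) → (∀ y → column (flow T₁) y + b₂ y ≤ b y) →
        (∀ x y → u₁ x y + u₂ x y ≤ u x y) → Transport a b u
merge T₁ T₂ a₁+a₂≡a T₁+b₂≤b u₁+u₂≤u = record
  { flow   = λ x y → flow T₁ x y + flow T₂ x y
  ; flow≤u = λ x y → ≤-trans (+-mono-≤ (flow≤u T₁ x y) (flow≤u T₂ x y)) (u₁+u₂≤u x y)
  ; supply = λ x → trans (∑-distrib-+ (flow T₁ x) (flow T₂ x))
                         (trans (cong₂ _+_ (supply T₁ x) (supply T₂ x)) (a₁+a₂≡a x))
  ; demand = λ y → ≤-trans (≤-reflexive (∑-distrib-+ (λ x → flow T₁ x y) (λ x → flow T₂ x y)))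
                           (≤-trans (+-monoʳ-≤ (column (flow T₁) y) (demand T₂ y)) (T₁+b₂≤b y))
  }

feasible-restrict : {a : Fin p → ℕ} {b : Fin q → ℕ} {u : Fin p → Fin q → ℕ} →
                    ∀ S → Feasible a b u → Feasible (restrict S a) b (restrictRows S u)
feasible-restrict {a = a} {b} {u} S feasible T = begin
  ∑⟨ T ⟩ (restrict S a)             ≡⟨ ∑⟨∩⟩ T S a ⟨
  ∑⟨ T ∩ S ⟩ a                      ≤⟨ feasible (T ∩ S) ⟩
  capacity b u (T ∩ S)              ≡⟨ sum-cong-≗ (λ y → cong (b y ⊓_) (∑⟨∩⟩ T S (λ x → u x y))) ⟩
  capacity b (restrictRows S u) T   ∎
  where open ≤-Reasoning

⊓-+-≤ : ∀ {b c v} w → c ≤ b → c ≤ v → b ⊓ (v + w) ≤ b ⊓ v + (b ∸ c) ⊓ w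
⊓-+-≤ {b} {c} {v} w c≤b c≤v with v ≤? b
... | no  v≰b = ≤-trans (m⊓n≤m b (v + w))
                  (≤-trans (≤-reflexive (sym (m≤n⇒m⊓n≡m (≰⇒≥ v≰b)))) (m≤m+n (b ⊓ v) _))
... | yes v≤b = begin
  b ⊓ (v + w)             ≡⟨ cong (_⊓ (v + w)) (m+[n∸m]≡n v≤b) ⟨
  (v + (b ∸ v)) ⊓ (v + w) ≡⟨ +-distribˡ-⊓ v (b ∸ v) w ⟨
  v + (b ∸ v) ⊓ w         ≤⟨ +-mono-≤ (≤-reflexive (sym (m≥n⇒m⊓n≡n v≤b))) (⊓-monoˡ-≤ w (∸-monoʳ-≤ b c≤v)) ⟩
  b ⊓ v + (b ∸ c) ⊓ w     ∎
  where open ≤-Reasoning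

feasible-remainder : {a : Fin p → ℕ} {b : Fin q → ℕ} {u : Fin p → Fin q → ℕ} →
                     ∀ S → Feasible a b u → capacity b u S ≤ ∑⟨ S ⟩ a →
                     (T₁ : Transport (restrict S a) b (restrictRows S u)) →
                     Feasible (restrict (∁ S) a) (λ y → b y ∸ column (flow T₁) y) (restrictRows (∁ S) u)
feasible-remainder {a = a} {b} {u} S feasible S-saturated T₁ T = +-cancelˡ-≤ (∑⟨ S ⟩ a) _ _ (begin
  ∑⟨ S ⟩ a + ∑⟨ T ⟩ (restrict (∁ S) a)  ≡⟨ ∑⟨∪⟩ S T a ⟨
  ∑⟨ S ∪ T ⟩ a                          ≤⟨ feasible (S ∪ T) ⟩
  capacity b u (S ∪ T)                  ≤⟨ sum-mono-≤ split ⟩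
  sum (λ y → b y ⊓ P y + b₂ y ⊓ Q y)    ≡⟨ ∑-distrib-+ (λ y → b y ⊓ P y) (λ y → b₂ y ⊓ Q y) ⟩
  capacity b u S + capacity b₂ u₂ T     ≤⟨ +-monoˡ-≤ (capacity b₂ u₂ T) S-saturated ⟩
  ∑⟨ S ⟩ a + capacity b₂ u₂ T           ∎)
  where
    open ≤-Reasoning
    b₂ = λ y → b y ∸ column (flow T₁) y
    u₂ = restrictRows (∁ S) u
    P = λ y → ∑⟨ S ⟩ (λ x → u x y)
    Q = λ y → ∑⟨ T ⟩ (λ x → u₂ x y)
    split : ∀ y → b y ⊓ ∑⟨ S ∪ T ⟩ (λ x → u x y) ≤ b y ⊓ P y + b₂ y ⊓ Q y
    split y rewrite ∑⟨∪⟩ S T (λ x → u x y) =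
      ⊓-+-≤ (Q y) (demand T₁ y) (sum-mono-≤ (λ x → flow≤u T₁ x y))

Tight : (Fin p → ℕ) → (Fin q → ℕ) → (Fin p → Fin q → ℕ) → Subset p → Set
Tight a b u S = 0 < ∑⟨ S ⟩ a × ∑⟨ S ⟩ a < sum a × capacity b u S ≤ ∑⟨ S ⟩ a

tight? : ∀ (a : Fin p → ℕ) (b : Fin q → ℕ) u S → Dec (Tight a b u S)
tight? a b u S = (0 <? ∑⟨ S ⟩ a) ×-dec (∑⟨ S ⟩ a <? sum a) ×-dec (capacity b u S ≤? ∑⟨ S ⟩ a)

TransportsBelow : ℕ → ℕ → ℕ → Set
TransportsBelow p q N = ∀ (a : Fin p → ℕ) (b : Fin q → ℕ) u → sum a < N → Feasible a b u → Transport a b u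

split-at-tight : {a : Fin p → ℕ} {b : Fin q → ℕ} {u : Fin p → Fin q → ℕ} →
                 TransportsBelow p q (sum a) → Feasible a b u → ∀ S → Tight a b u S → Transport a b u
split-at-tight {a = a} {b} {u} IH feasible S (0<∑Sa , ∑Sa<∑a , S-saturated) =
  merge T₁ T₂ (restrict-∁ S a) (λ y → ≤-reflexive (m+[n∸m]≡n (demand T₁ y)))
        (λ x y → ≤-reflexive (restrict-∁ S (λ x → u x y) x))
  where
    T₁ : Transport (restrict S a) b (restrictRows S u)
    T₁ = IH (restrict S a) b (restrictRows S u) ∑Sa<∑a (feasible-restrict {a = a} {b} {u} S feasible)
    T₂ : Transport (restrict (∁ S) a) (λ y → b y ∸ column (flow T₁) y) (restrictRows (∁ S) u)
    T₂ = IH (restrict (∁ S) a) _ (restrictRows (∁ S) u)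
            (subst (∑⟨ ∁ S ⟩ a <_) (∑⟨∁⟩ S a) (+-monoˡ-≤ (∑⟨ ∁ S ⟩ a) 0<∑Sa))
            (feasible-remainder {a = a} {b} {u} S feasible S-saturated T₁)

point : Fin q → Fin q → ℕ
point j = restrict ⁅ j ⁆ (λ _ → 1)

edge : Fin p → Fin q → Fin p → Fin q → ℕ
edge x₀ y₀ x y = lookup ⁅ x₀ ⁆ x · point y₀ y

unit-transport : (x₀ : Fin p) (y₀ : Fin q) → Transport (point x₀) (point y₀) (edge x₀ y₀)
unit-transport x₀ y₀ = record
  { flow   = edge x₀ y₀
  ; flow≤u = λ _ _ → ≤-refl
  ; supply = λ x → trans (sym (·-sum (lookup ⁅ x₀ ⁆ x) (point y₀)))
                         (cong (lookup ⁅ x₀ ⁆ x ·_) (∑⟨⁅⁆⟩ y₀ (λ _ → 1)))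
  ; demand = λ y → ≤-reflexive (∑⟨⁅⁆⟩ x₀ (λ _ → point y₀ y))
  }

⊓-≤-+ : ∀ {b b′ v v′ d} → b ≤ b′ + d → v ≤ v′ + d → b ⊓ v ≤ b′ ⊓ v′ + d
⊓-≤-+ {b′ = b′} {v′ = v′} {d} b≤ v≤ = ≤-trans (⊓-mono-≤ b≤ v≤) (≤-reflexive (sym (+-distribʳ-⊓ d b′ v′)))

module UnitStep {a : Fin p → ℕ} {b : Fin q → ℕ} {u : Fin p → Fin q → ℕ} {x₀ : Fin p} {y₀ : Fin q}
                (0<a₀ : 0 < a x₀) (0<b₀ : 0 < b y₀) (0<u₀₀ : 0 < u x₀ y₀) where

  a′ : Fin p → ℕ
  a′ x = a x ∸ point x₀ x

  b′ : Fin q → ℕ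
  b′ y = b y ∸ point y₀ y

  u′ : Fin p → Fin q → ℕ
  u′ x y = u x y ∸ edge x₀ y₀ x y

  ∑⟨⟩-a′ : ∀ S {s} → lookup S x₀ ≡ s → ∑⟨ S ⟩ a′ + s · 1 ≡ ∑⟨ S ⟩ a
  ∑⟨⟩-a′ S refl = ∑⟨⟩-∸-⁅⁆ S a 0<a₀

  ∑⟨⟩-a′-∌ : ∀ S → lookup S x₀ ≡ false → ∑⟨ S ⟩ a′ ≡ ∑⟨ S ⟩ a
  ∑⟨⟩-a′-∌ S x₀∉S = trans (sym (+-identityʳ _)) (∑⟨⟩-a′ S x₀∉S)

  capacity-drop : ∀ S → capacity b u S ≤ capacity b′ u′ S + 1
  capacity-drop S = ≤-trans (sum-mono-≤ drop) (≤-reflexive (trans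
    (∑-distrib-+ (λ y → b′ y ⊓ ∑⟨ S ⟩ (λ x → u′ x y)) (point y₀))
    (cong (capacity b′ u′ S +_) (∑⟨⁅⁆⟩ y₀ (λ _ → 1)))))
    where
      drop : ∀ y → b y ⊓ ∑⟨ S ⟩ (λ x → u x y) ≤ b′ y ⊓ ∑⟨ S ⟩ (λ x → u′ x y) + point y₀ y
      drop y = ⊓-≤-+ {b′ = b′ y} {v′ = ∑⟨ S ⟩ (λ x → u′ x y)} {d = point y₀ y}
        (≤-reflexive (sym (m∸n+n≡m (⁅⁆-·-≤ b 0<b₀ y))))
        (≤-trans (≤-reflexive (sym (∑⟨⟩-∸-⁅⁆ S (λ x → u x y) (⁅⁆-·-≤ (u x₀) 0<u₀₀ y))))
                 (+-monoʳ-≤ _ (·-≤ (lookup S x₀) (point y₀ y))))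

  -- For S ∋ x₀ both sides drop by one; otherwise S is not tight, so its slack
  -- absorbs the unit lost at y₀.
  feasible-after : Feasible a b u → (∀ S → ¬ Tight a b u S) → Feasible a′ b′ u′
  feasible-after feasible untight S with lookup S x₀ in x₀∈?S
  ... | true  = +-cancelʳ-≤ 1 _ _ (begin
    ∑⟨ S ⟩ a′ + 1         ≡⟨ ∑⟨⟩-a′ S x₀∈?S ⟩
    ∑⟨ S ⟩ a              ≤⟨ feasible S ⟩
    capacity b u S        ≤⟨ capacity-drop S ⟩
    capacity b′ u′ S + 1  ∎)
    where open ≤-Reasoning
  ... | false with ∑⟨ S ⟩ a ≟ 0
  ...   | yes ∑Sa≡0 = subst (_≤ capacity b′ u′ S) (sym (trans (∑⟨⟩-a′-∌ S x₀∈?S) ∑Sa≡0)) z≤n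
  ...   | no  ∑Sa≢0 = ≤-pred (begin
    suc (∑⟨ S ⟩ a′)        ≡⟨ cong suc (∑⟨⟩-a′-∌ S x₀∈?S) ⟩
    suc (∑⟨ S ⟩ a)         ≤⟨ ≰⇒> (λ saturated →
                                untight S (n≢0⇒n>0 ∑Sa≢0 , ∑⟨⟩-<-sum S a x₀∈?S 0<a₀ , saturated)) ⟩
    capacity b u S         ≤⟨ capacity-drop S ⟩
    capacity b′ u′ S + 1   ≡⟨ +-comm _ 1 ⟩
    suc (capacity b′ u′ S) ∎)
    where open ≤-Reasoning

  transport-via-unit : TransportsBelow p q (sum a) → Feasible a b u → (∀ S → ¬ Tight a b u S) → Transport a b u
  transport-via-unit IH feasible untight =
    merge (unit-transport x₀ y₀) (IH a′ b′ u′ ∑a′<∑a (feasible-after feasible untight))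
          (λ x → m+[n∸m]≡n (⁅⁆-·-≤ a 0<a₀ x))
          (λ y → ≤-reflexive (trans (cong (_+ b′ y) (∑⟨⁅⁆⟩ x₀ (λ _ → point y₀ y)))
                                    (m+[n∸m]≡n (⁅⁆-·-≤ b 0<b₀ y))))
          (λ x y → ≤-reflexive (m+[n∸m]≡n (⁅⁆-·-≤ (λ x → u x y) (⁅⁆-·-≤ (u x₀) 0<u₀₀ y) x)))
    where
      ∑a′<∑a : sum a′ < sum a
      ∑a′<∑a = subst (suc (sum a′) ≤_)
        (trans (cong (sum a′ +_) (sym (∑⟨⁅⁆⟩ x₀ (λ _ → 1)))) (sum-∸ a (point x₀) (⁅⁆-·-≤ a 0<a₀)))
        (≤-reflexive (+-comm 1 (sum a′)))

usable-edge : {a : Fin p → ℕ} {b : Fin q → ℕ} {u : Fin p → Fin q → ℕ} → Feasible a b u → 0 < sum a →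
              ∃₂ λ x₀ y₀ → 0 < a x₀ × 0 < b y₀ × 0 < u x₀ y₀
usable-edge {a = a} {b} {u} feasible 0<∑a with sum>0⇒∃>0 a 0<∑a
... | x₀ , 0<a₀ with sum>0⇒∃>0 (λ y → b y ⊓ ∑⟨ ⁅ x₀ ⁆ ⟩ (λ x → u x y))
                               (≤-trans (subst (0 <_) (sym (∑⟨⁅⁆⟩ x₀ a)) 0<a₀) (feasible ⁅ x₀ ⁆))
...   | y₀ , 0<b₀⊓u₀₀ = x₀ , y₀ , 0<a₀ , m≤n⊓o⇒m≤n _ _ 0<b₀⊓u₀₀
                      , subst (0 <_) (∑⟨⁅⁆⟩ x₀ (λ x → u x y₀)) (m≤n⊓o⇒m≤o _ _ 0<b₀⊓u₀₀)

transport-step : {a : Fin p → ℕ} {b : Fin q → ℕ} {u : Fin p → Fin q → ℕ} →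
                 TransportsBelow p q (sum a) → Feasible a b u → Transport a b u
transport-step {a = a} {b} {u} IH feasible with sum a ≟ 0 | anySubset? (tight? a b u)
... | yes ∑a≡0 | _                = null-transport ∑a≡0
... | no  _    | yes (S , S-tight) = split-at-tight IH feasible S S-tight
... | no  ∑a≢0 | no  ∄tight with usable-edge {a = a} {b} {u} feasible (n≢0⇒n>0 ∑a≢0)
...   | x₀ , y₀ , 0<a₀ , 0<b₀ , 0<u₀₀ =
  UnitStep.transport-via-unit {a = a} {b} {u} {x₀} {y₀} 0<a₀ 0<b₀ 0<u₀₀
    IH feasible (λ S S-tight → ∄tight (S , S-tight))

transport-acc : (a : Fin p → ℕ) (b : Fin q → ℕ) (u : Fin p → Fin q → ℕ) →
                Acc _<_ (sum a) → Feasible a b u → Transport a b u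
transport-acc a b u (acc below) =
  transport-step (λ a′ b′ u′ ∑a′<∑a → transport-acc a′ b′ u′ (below ∑a′<∑a))

transport : (a : Fin p → ℕ) (b : Fin q → ℕ) (u : Fin p → Fin q → ℕ) → Feasible a b u → Transport a b u
transport a b u = transport-acc a b u (<-wellFounded (sum a))

-- Regular bipartite multigraphs are unions of perfect matchings

record DisjointPerfectMatchings (j : ℕ) (W : Fin p → Fin p → ℕ) : Set where
  field
    matching  : Fin j → Fin p → Fin p
    supported : ∀ i l → 0 < W l (matching i l)
    injective : ∀ i → Injective _≡_ _≡_ (matching i)
    disjoint  : ∀ i i′ l → i ≢ i′ → matching i l ≡ matching i′ l → 2 ≤ W l (matching i l)
open DisjointPerfectMatchings

v≤c*[1⊓v] : ∀ {v} c → v ≤ c → v ≤ c * (1 ⊓ v)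
v≤c*[1⊓v] {zero}  c _   = z≤n
v≤c*[1⊓v] {suc v} c v≤c = ≤-trans v≤c (≤-reflexive (sym (*-identityʳ c)))

regular-feasible : ∀ j (W : Fin p → Fin p → ℕ) → (∀ l → sum (W l) ≡ suc j) → (∀ r → column W r ≡ suc j) →
                   Feasible (λ _ → 1) (λ _ → 1) W
regular-feasible j W rows cols S = *-cancelˡ-≤ (suc j) (begin
  suc j * ∑⟨ S ⟩ (λ _ → 1)                  ≡⟨ cong (suc j *_) (trans (∑⟨⟩-const S 1) (*-identityˡ ∣ S ∣)) ⟩
  suc j * ∣ S ∣                             ≡⟨ ∑⟨⟩-const S (suc j) ⟨
  ∑⟨ S ⟩ (λ _ → suc j)                      ≡⟨ sum-cong-≗ (λ l → cong (lookup S l ·_) (sym (rows l))) ⟩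
  ∑⟨ S ⟩ (λ l → sum (W l))                  ≡⟨ sum-cong-≗ (λ l → ·-sum (lookup S l) (W l)) ⟩
  sum (λ l → sum (λ r → lookup S l · W l r)) ≡⟨ ∑-comm (λ l r → lookup S l · W l r) ⟩
  sum (λ r → ∑⟨ S ⟩ (λ l → W l r))
    ≤⟨ sum-mono-≤ (λ r → v≤c*[1⊓v] (suc j) (≤-trans (∑⟨⟩-≤ S (λ l → W l r)) (≤-reflexive (cols r)))) ⟩
  sum (λ r → suc j * (1 ⊓ ∑⟨ S ⟩ (λ l → W l r)))
    ≡⟨ *-distribˡ-sum (suc j) (λ r → 1 ⊓ ∑⟨ S ⟩ (λ l → W l r)) ⟨
  suc j * capacity (λ _ → 1) W S            ∎)
  where open ≤-Reasoning

cons-matching : ∀ {j} (W g : Fin p → Fin p → ℕ) → (∀ l r → g l r ≤ W l r) →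
                (∀ l → sum (g l) ≡ 1) → (∀ r → column g r ≤ 1) →
                DisjointPerfectMatchings j (λ l r → W l r ∸ g l r) → DisjointPerfectMatchings (suc j) W
cons-matching {p} {j} W g g≤W rows cols D = record
  { matching = M ; supported = M-supported ; injective = M-injective ; disjoint = M-disjoint }
  where
    W′ = λ l r → W l r ∸ g l r

    M₀ : Fin p → Fin p
    M₀ l = proj₁ (sum>0⇒∃>0 (g l) (≤-reflexive (sym (rows l))))

    0<g[M₀] : ∀ l → 0 < g l (M₀ l)
    0<g[M₀] l = proj₂ (sum>0⇒∃>0 (g l) (≤-reflexive (sym (rows l))))

    M : Fin (suc j) → Fin p → Fin p
    M zero    = M₀
    M (suc i) = matching D i

    M-supported : ∀ i l → 0 < W l (M i l)
    M-supported zero    l = ≤-trans (0<g[M₀] l) (g≤W l (M₀ l))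
    M-supported (suc i) l = ≤-trans (supported D i l) (m∸n≤m _ (g l (M (suc i) l)))

    M-injective : ∀ i → Injective _≡_ _≡_ (M i)
    M-injective (suc i) = injective D i
    M-injective zero {l} {l′} M₀l≡M₀l′ with l Fin.≟ l′
    ... | yes l≡l′ = l≡l′
    ... | no  l≢l′ = contradiction (begin
      2                          ≤⟨ +-mono-≤ (0<g[M₀] l) (subst (λ r → 0 < g l′ r) (sym M₀l≡M₀l′) (0<g[M₀] l′)) ⟩
      g l (M₀ l) + g l′ (M₀ l)   ≤⟨ +-≤-sum (λ x → g x (M₀ l)) l≢l′ ⟩
      column g (M₀ l)            ≤⟨ cols (M₀ l) ⟩
      1                          ∎) (<-irrefl refl)
      where open ≤-Reasoning

    twice : ∀ l r → 0 < g l r → 0 < W′ l r → 2 ≤ W l r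
    twice l r 0<g 0<W′ = subst (2 ≤_) (m∸n+n≡m (g≤W l r)) (+-mono-≤ 0<W′ 0<g)

    M-disjoint : ∀ i i′ l → i ≢ i′ → M i l ≡ M i′ l → 2 ≤ W l (M i l)
    M-disjoint zero     zero     l 0≢0 _ = contradiction refl 0≢0
    M-disjoint zero     (suc i′) l _ M₀l≡ =
      twice l (M₀ l) (0<g[M₀] l) (subst (λ r → 0 < W′ l r) (sym M₀l≡) (supported D i′ l))
    M-disjoint (suc i)  zero     l _ ≡M₀l = subst (λ r → 2 ≤ W l r) (sym ≡M₀l)
      (twice l (M₀ l) (0<g[M₀] l) (subst (λ r → 0 < W′ l r) ≡M₀l (supported D i l)))
    M-disjoint (suc i)  (suc i′) l i≢i′ eq =
      ≤-trans (disjoint D i i′ l (λ i≡i′ → i≢i′ (cong suc i≡i′)) eq) (m∸n≤m _ (g l (M (suc i) l)))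

sum-∸-suc : ∀ {j} (f g : Fin p → ℕ) → (∀ i → g i ≤ f i) → sum g ≡ 1 → sum f ≡ suc j →
            sum (λ i → f i ∸ g i) ≡ j
sum-∸-suc {j = j} f g g≤f ∑g≡1 ∑f≡1+j = +-cancelʳ-≡ 1 _ _ (begin
  sum (λ i → f i ∸ g i) + 1      ≡⟨ cong (sum (λ i → f i ∸ g i) +_) ∑g≡1 ⟨
  sum (λ i → f i ∸ g i) + sum g  ≡⟨ sum-∸ f g g≤f ⟩
  sum f                          ≡⟨ ∑f≡1+j ⟩
  suc j                          ≡⟨ +-comm 1 j ⟩
  j + 1                          ∎)
  where open ≡-Reasoning

regular-decomposition : ∀ j (W : Fin p → Fin p → ℕ) → (∀ l → sum (W l) ≡ j) → (∀ r → column W r ≡ j) →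
                        DisjointPerfectMatchings j W
regular-decomposition zero    W _ _ = record
  { matching = λ () ; supported = λ () ; injective = λ () ; disjoint = λ () }
regular-decomposition (suc j) W rows cols =
  cons-matching W g (flow≤u P) (supply P) (demand P)
    (regular-decomposition j (λ l r → W l r ∸ g l r)
      (λ l → sum-∸-suc (W l) (g l) (flow≤u P l) (supply P l) (rows l))
      (λ r → sum-∸-suc (λ l → W l r) (λ l → g l r) (λ l → flow≤u P l r) (column-g≡1 r) (cols r)))
  where
    P : Transport (λ _ → 1) (λ _ → 1) W
    P = transport (λ _ → 1) (λ _ → 1) W (regular-feasible j W rows cols)
    g = flow P
    column-g≡1 : ∀ r → column g r ≡ 1
    column-g≡1 = sum-≤⇒≗ (column g) (λ _ → 1) (demand P)
                   (≤-reflexive (trans (sym (sum-cong-≗ (supply P))) (∑-comm g)))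

-- The binding-number hypothesis

allSubsets-complete : ∀ (S : Subset p) → S ∈ allSubsets p
allSubsets-complete []                    = here refl
allSubsets-complete {suc p} (inside ∷ S)  = ∈-++⁺ˡ (∈-map⁺ (inside ∷_) (allSubsets-complete S))
allSubsets-complete {suc p} (outside ∷ S) =
  ∈-++⁺ʳ (map (inside ∷_) (allSubsets p)) (∈-map⁺ (outside ∷_) (allSubsets-complete S))

foldr-⊓-≤ : ∀ q qs {r} → r ∈ q ∷ qs → foldr _⊓ℚ_ q qs ≤ℚ r
foldr-⊓-≤ q []       (here refl)         = ≤ℚ-refl
foldr-⊓-≤ q (x ∷ qs) (here refl)         = ≤ℚ-trans (p⊓q≤q x _) (foldr-⊓-≤ q qs (here refl))
foldr-⊓-≤ q (x ∷ qs) (there (here refl)) = p⊓q≤p x _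
foldr-⊓-≤ q (x ∷ qs) (there (there r∈))  = ≤ℚ-trans (p⊓q≤q x _) (foldr-⊓-≤ q qs (there r∈))

minimum-≤ : ∀ {qs r} → r ∈ qs → minimum qs ≤ℚ r
minimum-≤ {q ∷ qs} = foldr-⊓-≤ q qs

1≤minimum⇒nonempty : ∀ {A : Set} (f : A → ℚ) xs → 1ℚ ≤ℚ minimum (map f xs) → ∃ λ x → x ∈ xs
1≤minimum⇒nonempty f []       (*≤* (ℤ.+≤+ ()))
1≤minimum⇒nonempty f (x ∷ xs) _ = x , here refl

1≤ratio⇒≤ : ∀ a {c} → 0 < c → 1ℚ ≤ℚ ratio a c → c ≤ a
1≤ratio⇒≤ a {suc b} _ 1≤a/c with ℚᵘ.≤-respʳ-≃ (toℚᵘ-fromℚᵘ (mkℚᵘ (ℤ.+ a) b)) (toℚᵘ-mono-≤ 1≤a/c)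
... | ℚᵘ.*≤* 1+b≤a = ℤ.drop‿+≤+ (subst₂ ℤ._≤_ (ℤ.*-identityˡ (ℤ.+ suc b)) (ℤ.*-identityʳ (ℤ.+ a)) 1+b≤a)

Expanding : ℕ → BipartiteGraph → Set
Expanding k G = ∀ S → k ≤ ∣ S ∣ → ∣ S ∣ ≤ ∣ Λ k G S ∣

module _ (k : ℕ) (G : BipartiteGraph) (1≤β : 1ℚ ≤ℚ β k G) where

  private
    large? = λ (S : Subset (m G)) → k ≤? ∣ S ∣
    ratioΛ = λ (S : Subset (m G)) → ratio ∣ Λ k G S ∣ ∣ S ∣

  β≥1⇒k≤∣X∣ : k ≤ m G
  β≥1⇒k≤∣X∣ =
    let S , S∈ = 1≤minimum⇒nonempty ratioΛ (filter large? (allSubsets (m G))) 1≤β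
    in ≤-trans (proj₂ (∈-filter⁻ large? {xs = allSubsets (m G)} S∈)) (∣p∣≤n S)

  β≥1⇒expanding : 1 ≤ k → Expanding k G
  β≥1⇒expanding 1≤k S k≤∣S∣ = 1≤ratio⇒≤ ∣ Λ k G S ∣ (≤-trans 1≤k k≤∣S∣) (≤ℚ-trans 1≤β
    (minimum-≤ (∈-map⁺ ratioΛ (∈-filter⁺ large? {xs = allSubsets (m G)} (allSubsets-complete S) k≤∣S∣))))

extend : ∀ (S : Subset p) {k} → ∣ S ∣ ≤ k → k ≤ p → ∃ λ T → S ⊆ T × ∣ T ∣ ≡ k
extend []            {zero}  _           _         = [] , (λ ()) , refl
extend (inside ∷ S)  {suc k} (s≤s ∣S∣≤k) (s≤s k≤p) =
  let T , S⊆T , ∣T∣≡k = extend S ∣S∣≤k k≤p in inside ∷ T , in⊆in S⊆T , cong suc ∣T∣≡k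
extend {suc p} (outside ∷ S) {k} ∣S∣≤k k≤1+p with k ≤? p
... | yes k≤p = let T , S⊆T , ∣T∣≡k = extend S ∣S∣≤k k≤p in outside ∷ T , s⊆s S⊆T , ∣T∣≡k
... | no  k≰p = ⊤ , ⊆⊤ , trans (∣⊤∣≡n (suc p)) (≤-antisym (≰⇒> k≰p) k≤1+p)

∣S∣≤∣S∩T∣⇒S⊆T : ∀ (S T : Subset p) → ∣ S ∣ ≤ ∣ S ∩ T ∣ → S ⊆ T
∣S∣≤∣S∩T∣⇒S⊆T S T ∣S∣≤∣S∩T∣ {x} x∈S with x ∈? T
... | yes x∈T = x∈T
... | no  x∉T = contradiction ∣S∣≤∣S∩T∣
  (<⇒≱ (p⊂q⇒∣p∣<∣q∣ (p∩q⊆p S T , x , x∈S , λ x∈S∩T → x∉T (proj₂ (x∈p∩q⁻ S T x∈S∩T)))))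

adjacency : (G : BipartiteGraph) → Fin (m G) → Fin (n G) → ℕ
adjacency G x y = adj G x y · 1

∣tabulate∣ : ∀ (f : Fin p → Bool) → ∣ tabulate f ∣ ≡ sum (λ i → f i · 1)
∣tabulate∣ f = trans (∣∣≡∑⟨⟩ (tabulate f)) (sum-cong-≗ λ i → cong (_· 1) (lookup∘tabulate f i))

∣∩nbrX∣ : ∀ G (S : Subset (m G)) y → ∣ S ∩ nbrX G y ∣ ≡ ∑⟨ S ⟩ (λ x → adjacency G x y)
∣∩nbrX∣ G S y = trans (∣∣≡∑⟨⟩ (S ∩ nbrX G y)) (trans (∑⟨∩⟩ S (nbrX G y) (λ _ → 1))
  (sum-cong-≗ λ x → cong (λ t → lookup S x · t · 1) (lookup∘tabulate (λ x → adj G x y) x)))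

*∣Λ∣≤capacity : ∀ k G S T c → c ≤ k → (∀ y → k ≤ ∣ T ∩ nbrX G y ∣ → c ≤ ∣ S ∩ nbrX G y ∣) →
             c * ∣ Λ k G T ∣ ≤ capacity (λ _ → k) (adjacency G) S
*∣Λ∣≤capacity k G S T c c≤k Λ-bound = begin
  c * ∣ Λ k G T ∣                      ≡⟨ cong (c *_) (∣tabulate∣ (λ y → ⌊ k ≤? ∣ T ∩ nbrX G y ∣ ⌋)) ⟩
  c * sum (λ y → inΛ y · 1)            ≡⟨ *-distribˡ-sum c (λ y → inΛ y · 1) ⟩
  sum (λ y → c * (inΛ y · 1))          ≤⟨ sum-mono-≤ bound ⟩
  capacity (λ _ → k) (adjacency G) S   ∎
  where
    open ≤-Reasoning
    inΛ = λ y → ⌊ k ≤? ∣ T ∩ nbrX G y ∣ ⌋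
    bound : ∀ y → c * (inΛ y · 1) ≤ k ⊓ ∑⟨ S ⟩ (λ x → adjacency G x y)
    bound y with k ≤? ∣ T ∩ nbrX G y ∣
    ... | yes y∈Λ = subst₂ _≤_ (sym (*-identityʳ c)) (cong (k ⊓_) (∣∩nbrX∣ G S y)) (⊓-glb c≤k (Λ-bound y y∈Λ))
    ... | no  _   = subst (_≤ k ⊓ ∑⟨ S ⟩ (λ x → adjacency G x y)) (sym (*-zeroʳ c)) z≤n

expanding-feasible : ∀ k G → k ≤ m G → Expanding k G → Feasible (λ _ → k) (λ _ → k) (adjacency G)
expanding-feasible k G k≤∣X∣ expanding S with k ≤? ∣ S ∣
... | yes k≤∣S∣ = begin
  ∑⟨ S ⟩ (λ _ → k)                     ≡⟨ ∑⟨⟩-const S k ⟩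
  k * ∣ S ∣                            ≤⟨ *-monoʳ-≤ k (expanding S k≤∣S∣) ⟩
  k * ∣ Λ k G S ∣                      ≤⟨ *∣Λ∣≤capacity k G S S k ≤-refl (λ _ k≤d → k≤d) ⟩
  capacity (λ _ → k) (adjacency G) S   ∎
  where open ≤-Reasoning
... | no  k≰∣S∣ =
  let ∣S∣≤k = <⇒≤ (≰⇒> k≰∣S∣)
      T , S⊆T , ∣T∣≡k = extend S ∣S∣≤k k≤∣X∣
      k≤∣ΛT∣ = subst (_≤ ∣ Λ k G T ∣) ∣T∣≡k (expanding T (≤-reflexive (sym ∣T∣≡k)))
      S-inside : ∀ y → k ≤ ∣ T ∩ nbrX G y ∣ → ∣ S ∣ ≤ ∣ S ∩ nbrX G y ∣
      S-inside y k≤d = p⊆q⇒∣p∣≤∣q∣ λ x∈S →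
        x∈p∩q⁺ (x∈S , ∣S∣≤∣S∩T∣⇒S⊆T T (nbrX G y) (subst (_≤ ∣ T ∩ nbrX G y ∣) (sym ∣T∣≡k) k≤d) (S⊆T x∈S))
  in begin
  ∑⟨ S ⟩ (λ _ → k)                     ≡⟨ ∑⟨⟩-const S k ⟩
  k * ∣ S ∣                            ≡⟨ *-comm k ∣ S ∣ ⟩
  ∣ S ∣ * k                            ≤⟨ *-monoʳ-≤ ∣ S ∣ k≤∣ΛT∣ ⟩
  ∣ S ∣ * ∣ Λ k G T ∣                  ≤⟨ *∣Λ∣≤capacity k G S T ∣ S ∣ ∣S∣≤k S-inside ⟩
  capacity (λ _ → k) (adjacency G) S   ∎
  where open ≤-Reasoning

module Completion {p q : ℕ} (k : ℕ) (H : Fin p → Fin q → ℕ)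
                  (rows : ∀ x → sum (H x) ≡ k) (columns : ∀ y → column H y ≤ k) where

  -- The Y × Y diagonal tops every vertex of Y up to degree k; no X × X block is
  -- needed since H has degree k on X already.
  block : Fin p ⊎ Fin q → Fin p ⊎ Fin q → ℕ
  block (inj₁ _) (inj₁ _)  = 0
  block (inj₁ x) (inj₂ y)  = H x y
  block (inj₂ y) (inj₁ x)  = H x y
  block (inj₂ y) (inj₂ y′) = lookup ⁅ y ⁆ y′ · (k ∸ column H y)

  completion : Fin (p + q) → Fin (p + q) → ℕ
  completion l r = block (splitAt p l) (splitAt p r)

  sum-splitAt : ∀ (F : Fin p ⊎ Fin q → ℕ) →
                sum (λ r → F (splitAt p r)) ≡ sum (λ x → F (inj₁ x)) + sum (λ y → F (inj₂ y))
  sum-splitAt F = trans (sum-↑ p (λ r → F (splitAt p r)))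
    (cong₂ _+_ (sum-cong-≗ λ x → cong F (splitAt-↑ˡ p x q)) (sum-cong-≗ λ y → cong F (splitAt-↑ʳ p q y)))

  block-rows : ∀ s → sum (λ r → block s (splitAt p r)) ≡ k
  block-rows (inj₁ x) = trans (sum-splitAt (block (inj₁ x))) (cong₂ _+_ (sum-replicate-zero p) (rows x))
  block-rows (inj₂ y) = trans (sum-splitAt (block (inj₂ y)))
    (trans (cong (column H y +_) (∑⟨⁅⁆⟩ y (λ _ → k ∸ column H y))) (m+[n∸m]≡n (columns y)))

  block-columns : ∀ s → sum (λ l → block (splitAt p l) s) ≡ k
  block-columns (inj₁ x) = trans (sum-splitAt (λ s → block s (inj₁ x))) (cong₂ _+_ (sum-replicate-zero p) (rows x))
  block-columns (inj₂ y′) = trans (sum-splitAt (λ s → block s (inj₂ y′)))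
    (trans (cong (column H y′ +_) (trans (sum-cong-≗ λ y → cong (_· (k ∸ column H y)) (⁅⁆-sym y y′))
                                           (∑⟨⁅⁆⟩ y′ (λ y → k ∸ column H y))))
           (m+[n∸m]≡n (columns y′)))

  completion-rows : ∀ l → sum (completion l) ≡ k
  completion-rows l = block-rows (splitAt p l)

  completion-columns : ∀ r → column completion r ≡ k
  completion-columns r = block-columns (splitAt p r)

  completion-↑ : ∀ x y → completion (x ↑ˡ q) (p ↑ʳ y) ≡ H x y
  completion-↑ x y = cong₂ block (splitAt-↑ˡ p x q) (splitAt-↑ʳ p q y)

  row-support : ∀ x r → 0 < completion (x ↑ˡ q) r → ∃ λ y → p ↑ʳ y ≡ r × 0 < H x y
  row-support x r 0<W = into-Y (splitAt p r) refl (subst (λ s → 0 < block s (splitAt p r)) (splitAt-↑ˡ p x q) 0<W)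
    where
      into-Y : ∀ s → splitAt p r ≡ s → 0 < block (inj₁ x) s → ∃ λ y → p ↑ʳ y ≡ r × 0 < H x y
      into-Y (inj₂ y) r↦y 0<H = y , splitAt⁻¹-↑ʳ r↦y , 0<H

module _ (k : ℕ) (G : BipartiteGraph) (H : Transport (λ _ → k) (λ _ → k) (adjacency G)) where

  open Completion k (flow H) (supply H) (demand H)

  private
    D : DisjointPerfectMatchings k completion
    D = regular-decomposition k completion completion-rows completion-columns

    route : ∀ i x → ∃ λ y → m G ↑ʳ y ≡ matching D i (x ↑ˡ n G) × 0 < flow H x y
    route i x = row-support x _ (supported D i (x ↑ˡ n G))

    same-route : ∀ {i j x x′} → proj₁ (route i x) ≡ proj₁ (route j x′) →
                 matching D i (x ↑ˡ n G) ≡ matching D j (x′ ↑ˡ n G)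
    same-route {i} {j} {x} {x′} eq =
      trans (sym (proj₁ (proj₂ (route i x)))) (trans (cong (m G ↑ʳ_) eq) (proj₁ (proj₂ (route j x′))))

    flow≤1 : ∀ x y → flow H x y ≤ 1
    flow≤1 x y = ≤-trans (flow≤u H x y) (·-≤ (adj G x y) 1)

  matchings : Fin k → XMatching G
  matchings i = record
    { mate      = λ x → proj₁ (route i x)
    ; isEdge    = λ x → 0<·⇒true (adj G x _) (≤-trans (proj₂ (proj₂ (route i x))) (flow≤u H x _))
    ; injective = λ {x} {x′} eq → ↑ˡ-injective (n G) x x′ (injective D i (same-route eq))
    }

  matchings-disjoint : ∀ i j → i ≢ j → EdgeDisjoint (matchings i) (matchings j)
  matchings-disjoint i j i≢j x eq = contradiction (begin
    2                                                 ≤⟨ disjoint D i j (x ↑ˡ n G) i≢j (same-route eq) ⟩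
    completion (x ↑ˡ n G) (matching D i (x ↑ˡ n G))   ≡⟨ cong (completion (x ↑ˡ n G)) (proj₁ (proj₂ (route i x))) ⟨
    completion (x ↑ˡ n G) (m G ↑ʳ y)                  ≡⟨ completion-↑ x y ⟩
    flow H x y                                        ≤⟨ flow≤1 x y ⟩
    1                                                 ∎) (<-irrefl refl)
    where
      open ≤-Reasoning
      y = proj₁ (route i x)

theorem1p4 : (k : ℕ) → k ≥ 1 → (G : BipartiteGraph) → 1ℚ ≤ℚ β k G →
    Σ (Fin k → XMatching G) (λ M → ∀ i j → i ≢ j → EdgeDisjoint (M i) (M j))
theorem1p4 k k≥1 G 1≤β = matchings k G H , matchings-disjoint k G H
  where
    H : Transport (λ _ → k) (λ _ → k) (adjacency G)
    H = transport _ _ _ (expanding-feasible k G (β≥1⇒k≤∣X∣ k G 1≤β) (β≥1⇒expanding k G 1≤β k≥1))
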